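{- Let $G$ be a finite simple graph with $\gamma(G)=1$ that contains the path $P_4$ on four vertices as an induced subgraph. Then no $1$-witness of $G$ is free, i.e., every $1$-witness of $G$ is neither left-free nor right-free.
   Context: All graphs are finite, simple and undirected. A graph $G=(V,E)$ is a star-$k$-PCG if there exist a weight function $w:V\to\mathbb{R}^+$ and $k$ pairwise disjoint intervals $I_1,\dots,I_k$ such that for distinct $u,v\in V$, $uv\in E$ if and only if $w(u)+w(v)\in\bigcup_i I_i$; the weighted graph $G^w$ with these intervals is a $k$-witness. Intervals are $I_i=[a_i,b_i]$ with $b_i<a_{i+1}$. The star number $\gamma(G)$ is the least positive $k$ such that $G$ is a star-$k$-PCG. For distinct $u,v$, $w(uv)=w(u)+w(v)$. For $\gamma(G)=k$, a $k$-witness is left-free if every non-edge $e$ satisfies $w(e)>b_1$, right-free if every non-edge $e$ satisfies $w(e)<a_k$, and free if it is left-free or right-free. -}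

module Defs where

open import Data.Nat using (ℕ; suc) renaming (_≤_ to _≤ℕ_)
open import Data.Fin using (Fin; toℕ; fromℕ; zero)
open import Data.Product using (Σ; ∃; _×_; _,_)
open import Data.Sum using (_⊎_)
open import Relation.Nullary using (¬_)
open import Relation.Binary.PropositionalEquality using (_≡_; _≢_)
open import Relation.Binary.Structures using (IsStrictTotalOrder)
open import Algebra.Structures using (IsCommutativeRing)
open import Function.Bundles using (_⇔_)

record RealNumbers : Set₁ where
  infixl 6 _+_
  infixl 7 _*_
  infix 4 _<_ _≤_
  field
    ℝ   : Set
    _+_ : ℝ → ℝ → ℝ
    _*_ : ℝ → ℝ → ℝ
    -_  : ℝ → ℝ
    0#  : ℝ
    1#  : ℝ
    _<_ : ℝ → ℝ → Set
    isCommutativeRing   : IsCommutativeRing _≡_ _+_ _*_ -_ 0# 1#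
    isStrictTotalOrder  : IsStrictTotalOrder _≡_ _<_
    inverse  : ∀ x → x ≢ 0# → ∃ λ y → x * y ≡ 1#
    +-mono-< : ∀ {x y} z → x < y → x + z < y + z
    *-pos    : ∀ {x y} → 0# < x → 0# < y → 0# < x * y
  _≤_ : ℝ → ℝ → Set
  x ≤ y = x < y ⊎ x ≡ y
  field
    sup : (S : ℝ → Set) → ∃ S → (∃ λ u → ∀ x → S x → x ≤ u) →
          ∃ λ s → (∀ x → S x → x ≤ s) × (∀ u → (∀ x → S x → x ≤ u) → s ≤ u)

record Graph (n : ℕ) : Set₁ where
  field
    Adj    : Fin n → Fin n → Set
    sym    : ∀ {u v} → Adj u v → Adj v u
    irrefl : ∀ {u} → ¬ Adj u u

open Graph public

P4Adj : Fin 4 → Fin 4 → Set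
P4Adj i j = suc (toℕ i) ≡ toℕ j ⊎ suc (toℕ j) ≡ toℕ i

HasInducedP4 : ∀ {n} → Graph n → Set
HasInducedP4 {n} G =
  Σ (Fin 4 → Fin n) λ f →
    (∀ i j → f i ≡ f j → i ≡ j) × (∀ i j → (Adj G (f i) (f j) ⇔ P4Adj i j))

module _ (R : RealNumbers) where
  open RealNumbers R

  record Witness {n} (G : Graph n) (k : ℕ) : Set where
    field
      w     : Fin n → ℝ
      w-pos : ∀ v → 0# < w v
      a b   : Fin k → ℝ
      a≤b   : ∀ i → a i ≤ b i
      sep   : ∀ (i j : Fin k) → suc (toℕ i) ≡ toℕ j → b i < a j
      edge  : ∀ u v → u ≢ v →
              (Adj G u v ⇔ ∃ λ i → a i ≤ w u + w v × w u + w v ≤ b i)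

  open Witness public

  IsStarPCG : ∀ {n} → Graph n → ℕ → Set
  IsStarPCG G k = Witness G k

  StarNumber : ∀ {n} → Graph n → ℕ → Set
  StarNumber G k = 1 ≤ℕ k × IsStarPCG G k × (∀ j → 1 ≤ℕ j → IsStarPCG G j → k ≤ℕ j)

  LeftFree : ∀ {n} {G : Graph n} {m} → Witness G (suc m) → Set
  LeftFree {G = G} W = ∀ u v → u ≢ v → ¬ Adj G u v → b W zero < w W u + w W v

  RightFree : ∀ {n} {G : Graph n} {m} → Witness G (suc m) → Set
  RightFree {G = G} {m} W = ∀ u v → u ≢ v → ¬ Adj G u v → w W u + w W v < a W (fromℕ m)

{-# OPTIONS --safe #-}
-- An induced P4 p₀p₁p₂p₃ has edges p₀p₁, p₂p₃ and non-edges p₀p₂, p₁p₃ with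
-- w(p₀p₁) + w(p₂p₃) = w(p₀p₂) + w(p₁p₃). The single interval [a₁, b₁] contains
-- both edge weights, so left-freeness would give 2b₁ ≥ w(p₀p₁) + w(p₂p₃) =
-- w(p₀p₂) + w(p₁p₃) > 2b₁, and right-freeness symmetrically 2a₁ ≤ … < 2a₁.
module Submission where

open import Defs
open import Data.Nat using (ℕ)
open import Data.Fin using (Fin; zero; suc)
open import Data.Product using (_×_; _,_; proj₁; proj₂)
open import Data.Sum using (inj₁; inj₂)
open import Data.Empty using (⊥)
open import Relation.Nullary using (¬_)
open import Relation.Binary.PropositionalEquality using (_≢_; refl; subst; subst₂)
open import Relation.Binary.Structures using (IsStrictTotalOrder)
open import Algebra.Bundles using (CommutativeSemigroup)
open import Algebra.Structures using (IsCommutativeRing)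
import Algebra.Properties.CommutativeSemigroup as CommutativeSemigroupProperties
open import Function.Bundles using (Equivalence)

module OrderedFieldProperties (R : RealNumbers) where
  open RealNumbers R
  open IsCommutativeRing isCommutativeRing using (+-comm; +-isCommutativeSemigroup)
  open IsStrictTotalOrder isStrictTotalOrder renaming (irrefl to <-irrefl-≡; trans to <-trans)

  +-commutativeSemigroup : CommutativeSemigroup _ _
  +-commutativeSemigroup = record { isCommutativeSemigroup = +-isCommutativeSemigroup }

  open CommutativeSemigroupProperties +-commutativeSemigroup using (interchange)

  <-irrefl : ∀ {x} → ¬ x < x
  <-irrefl = <-irrefl-≡ refl

  ≤-<-trans : ∀ {x y z} → x ≤ y → y < z → x < z
  ≤-<-trans (inj₁ x<y) y<z = <-trans x<y y<z
  ≤-<-trans (inj₂ refl) y<z = y<z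

  <-≤-trans : ∀ {x y z} → x < y → y ≤ z → x < z
  <-≤-trans x<y (inj₁ y<z) = <-trans x<y y<z
  <-≤-trans x<y (inj₂ refl) = x<y

  +-monoʳ-< : ∀ {x y} z → x < y → z + x < z + y
  +-monoʳ-< {x} {y} z x<y = subst₂ _<_ (+-comm x z) (+-comm y z) (+-mono-< z x<y)

  +-mono-<-< : ∀ {x y z t} → x < y → z < t → x + z < y + t
  +-mono-<-< {y = y} {z = z} x<y z<t = <-trans (+-mono-< z x<y) (+-monoʳ-< y z<t)

  +-mono-≤ : ∀ {x y z t} → x ≤ y → z ≤ t → x + z ≤ y + t
  +-mono-≤ (inj₁ x<y) (inj₁ z<t) = inj₁ (+-mono-<-< x<y z<t)
  +-mono-≤ {z = z} (inj₁ x<y) (inj₂ refl) = inj₁ (+-mono-< z x<y)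
  +-mono-≤ {x = x} (inj₂ refl) (inj₁ z<t) = inj₁ (+-monoʳ-< x z<t)
  +-mono-≤ (inj₂ refl) (inj₂ refl) = inj₂ refl

  ¬[sums≤c∧crossedSums>c] : ∀ {x y z t c} → x + y ≤ c → z + t ≤ c →
                            c < x + z → c < y + t → ⊥
  ¬[sums≤c∧crossedSums>c] {x} {y} {z} {t} {c} xy≤c zt≤c c<xz c<yt =
    <-irrefl (≤-<-trans (+-mono-≤ xy≤c zt≤c)
      (subst (c + c <_) (interchange x z y t) (+-mono-<-< c<xz c<yt)))

  ¬[sums≥c∧crossedSums<c] : ∀ {x y z t c} → c ≤ x + y → c ≤ z + t →
                            x + z < c → y + t < c → ⊥
  ¬[sums≥c∧crossedSums<c] {x} {y} {z} {t} {c} c≤xy c≤zt xz<c yt<c =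
    <-irrefl (<-≤-trans
      (subst (_< c + c) (interchange x z y t) (+-mono-<-< xz<c yt<c))
      (+-mono-≤ c≤xy c≤zt))

record CrossedEdges {n} (G : Graph n) : Set where
  field
    x y z t : Fin n
    xy-adj  : Adj G x y
    zt-adj  : Adj G z t
    x≢z     : x ≢ z
    xz-nadj : ¬ Adj G x z
    y≢t     : y ≢ t
    yt-nadj : ¬ Adj G y t

inducedP4⇒crossedEdges : ∀ {n} {G : Graph n} → HasInducedP4 G → CrossedEdges G
inducedP4⇒crossedEdges (f , f-inj , f-induced) = record
  { x = f p₀ ; y = f p₁ ; z = f p₂ ; t = f p₃
  ; xy-adj  = Equivalence.from (f-induced p₀ p₁) (inj₁ refl)
  ; zt-adj  = Equivalence.from (f-induced p₂ p₃) (inj₁ refl)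
  ; x≢z     = λ eq → p₀≢p₂ (f-inj p₀ p₂ eq)
  ; xz-nadj = λ adj → ¬P4Adj-p₀p₂ (Equivalence.to (f-induced p₀ p₂) adj)
  ; y≢t     = λ eq → p₁≢p₃ (f-inj p₁ p₃ eq)
  ; yt-nadj = λ adj → ¬P4Adj-p₁p₃ (Equivalence.to (f-induced p₁ p₃) adj)
  }
  where
  p₀ p₁ p₂ p₃ : Fin 4
  p₀ = zero
  p₁ = suc zero
  p₂ = suc (suc zero)
  p₃ = suc (suc (suc zero))

  p₀≢p₂ : p₀ ≢ p₂
  p₀≢p₂ ()

  p₁≢p₃ : p₁ ≢ p₃
  p₁≢p₃ ()

  ¬P4Adj-p₀p₂ : ¬ P4Adj p₀ p₂
  ¬P4Adj-p₀p₂ (inj₁ ())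
  ¬P4Adj-p₀p₂ (inj₂ ())

  ¬P4Adj-p₁p₃ : ¬ P4Adj p₁ p₃
  ¬P4Adj-p₁p₃ (inj₁ ())
  ¬P4Adj-p₁p₃ (inj₂ ())

module OneWitness (R : RealNumbers) {n} {G : Graph n} (W : Witness R G 1) where
  open RealNumbers R
  open OrderedFieldProperties R

  adj⇒weight∈I₁ : ∀ {u v} → Adj G u v → a W zero ≤ w W u + w W v × w W u + w W v ≤ b W zero
  adj⇒weight∈I₁ {u} {v} adj with Equivalence.to (edge W u v (λ { refl → irrefl G adj })) adj
  ... | zero , weight∈I₁ = weight∈I₁

  crossedEdges⇒¬leftFree : CrossedEdges G → ¬ LeftFree R W
  crossedEdges⇒¬leftFree c left-free =
    ¬[sums≤c∧crossedSums>c]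
      (proj₂ (adj⇒weight∈I₁ xy-adj)) (proj₂ (adj⇒weight∈I₁ zt-adj))
      (left-free x z x≢z xz-nadj) (left-free y t y≢t yt-nadj)
    where open CrossedEdges c

  crossedEdges⇒¬rightFree : CrossedEdges G → ¬ RightFree R W
  crossedEdges⇒¬rightFree c right-free =
    ¬[sums≥c∧crossedSums<c]
      (proj₁ (adj⇒weight∈I₁ xy-adj)) (proj₁ (adj⇒weight∈I₁ zt-adj))
      (right-free x z x≢z xz-nadj) (right-free y t y≢t yt-nadj)
    where open CrossedEdges c

theorem1 : (R : RealNumbers) → (n : ℕ) → (G : Graph n) →
    StarNumber R G 1 → HasInducedP4 G →
    (W : Witness R G 1) → ¬ LeftFree R W × ¬ RightFree R W
theorem1 R n G _ inducedP4 W =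
  crossedEdges⇒¬leftFree crossed , crossedEdges⇒¬rightFree crossed
  where
  open OneWitness R W
  crossed : CrossedEdges G
  crossed = inducedP4⇒crossedEdges inducedP4
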